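{- Every finite rational ultrametric space is a regular rational branch space.
   Context: A metric space is rational if all distances are rational numbers, and ultrametric if $\rho(x,z)\leq\max\{\rho(x,y),\rho(y,z)\}$ for all $x,y,z$. A metric space $(T,\rho)$ is a rational tree space if there are a partial order $\leq$ on $T$ making $T$ a tree and a nonincreasing function $h:T\to\mathbb Q$ such that for distinct $x,y\in T$, $\rho(x,y)=\inf\{h(z): z\leq x \text{ and } z\leq y\}$. A metric space $(X,\rho)$ is a rational branch space if it is a (metric) subspace of some rational tree space $(T,\leq,h)$ with every element of $X$ being a leaf (maximal node) of $T$. It is a regular rational branch space if moreover all elements of $X$ have the same height in $T$ and the function $h$ is constant on each level of $T$. -}

module Defs where

open import Data.Fin using (Fin)
open import Data.Nat using (ℕ)
open import Data.Rational using (ℚ; 0ℚ; _+_; _⊔_) renaming (_≤_ to _≤ℚ_)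
open import Data.Product using (Σ; ∃; _×_; _,_; proj₁; proj₂)
open import Data.Sum using (_⊎_)
open import Relation.Binary.PropositionalEquality using (_≡_; _≢_)
open import Relation.Binary.Structures using (IsPartialOrder)
open import Induction.WellFounded using (WellFounded)

record IsMetric {X : Set} (d : X → X → ℚ) : Set where
  field
    nonneg   : ∀ x y → 0ℚ ≤ℚ d x y
    self     : ∀ x → d x x ≡ 0ℚ
    zero⇒≡   : ∀ x y → d x y ≡ 0ℚ → x ≡ y
    symm     : ∀ x y → d x y ≡ d y x
    triangle : ∀ x y z → d x z ≤ℚ d x y + d y z

IsUltrametric : {X : Set} → (X → X → ℚ) → Set
IsUltrametric d = ∀ x y z → d x z ≤ℚ (d x y ⊔ d y z)

IsInfimum : (ℚ → Set) → ℚ → Set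
IsInfimum S r = (∀ q → S q → r ≤ℚ q) × (∀ q → (∀ s → S s → q ≤ℚ s) → q ≤ℚ r)

module TreeNotions {T : Set} (_≤_ : T → T → Set) where
  _<_ : T → T → Set
  a < b = a ≤ b × a ≢ b

  Below : T → Set
  Below x = Σ T (λ z → z ≤ x)

  StrictBelow : T → Set
  StrictBelow x = Σ T (λ z → z < x)

  record IsTree : Set where
    field
      isPartialOrder : IsPartialOrder _≡_ _≤_
      belowLinear    : ∀ x a b → a ≤ x → b ≤ x → (a ≤ b) ⊎ (b ≤ a)
      belowWF        : ∀ x → WellFounded (λ (a b : Below x) → proj₁ a < proj₁ b)

  -- x and y have the same height: the (well-ordered) sets of their strict
  -- predecessors are order-isomorphic (same order type).
  record SameHeight (x y : T) : Set where
    field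
      to      : StrictBelow x → StrictBelow y
      from    : StrictBelow y → StrictBelow x
      from∘to : ∀ a → proj₁ (from (to a)) ≡ proj₁ a
      to∘from : ∀ b → proj₁ (to (from b)) ≡ proj₁ b
      to-mono   : ∀ a a′ → proj₁ a ≤ proj₁ a′ → proj₁ (to a) ≤ proj₁ (to a′)
      from-mono : ∀ b b′ → proj₁ b ≤ proj₁ b′ → proj₁ (from b) ≤ proj₁ (from b′)

  IsLeaf : T → Set
  IsLeaf x = ∀ t → x ≤ t → t ≡ x

record RationalTreeSpace : Set₁ where
  field
    T      : Set
    ρ      : T → T → ℚ
    metric : IsMetric ρ
    _≤_    : T → T → Set
  open TreeNotions _≤_ public
  field
    tree      : IsTree
    h         : T → ℚ
    h-nonincr : ∀ x y → x ≤ y → h y ≤ℚ h x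
    ρ-inf     : ∀ x y → x ≢ y →
                IsInfimum (λ q → ∃ λ z → z ≤ x × z ≤ y × q ≡ h z) (ρ x y)

IsRationalBranchSpace : {X : Set} → (X → X → ℚ) → Set₁
IsRationalBranchSpace {X} d =
  Σ RationalTreeSpace λ 𝕋 → let open RationalTreeSpace 𝕋 in
  Σ (X → T) λ e →
    (∀ x y → ρ (e x) (e y) ≡ d x y) ×
    (∀ x → IsLeaf (e x))

IsRegularRationalBranchSpace : {X : Set} → (X → X → ℚ) → Set₁
IsRegularRationalBranchSpace {X} d =
  Σ RationalTreeSpace λ 𝕋 → let open RationalTreeSpace 𝕋 in
  Σ (X → T) λ e →
    (∀ x y → ρ (e x) (e y) ≡ d x y) ×
    (∀ x → IsLeaf (e x)) ×
    (∀ x y → SameHeight (e x) (e y)) ×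
    (∀ s t → SameHeight s t → h s ≡ h t)

-- List the nonzero distances of X in decreasing order, r₀ ≥ r₁ ≥ … ≥ r_{L-1} > r_L = 0.
-- The nodes of level l of the tree are the closed balls of radius r_l (each
-- represented by its least point), ordered by reverse inclusion, with
-- h(ball of level l) = r_l.  The points of X are the balls of radius 0 at the
-- common level L.  Because d is an ultrametric, the balls of a fixed radius
-- partition X, so every node has exactly one ancestor on each lower level; hence
-- the height of a node is its level and h is constant on levels.  The largest
-- common ancestor of x and y is the ball of radius d(x,y), which gives
-- ρ(x,y) = d(x,y).
module Submission where

open import Defs
open import Axiom.UniquenessOfIdentityProofs using (module Decidable⇒UIP)
open import Data.Fin as Fin using (Fin; zero; suc; fromℕ<)
import Data.Fin.Properties as Finₚ
open import Data.List using (List; []; _∷_; length; filter; cartesianProductWith; allFin)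
open import Data.List.Membership.Propositional using (_∈_)
open import Data.List.Membership.Propositional.Properties
  using (∈-allFin; ∈-cartesianProductWith⁺; ∈-filter⁺)
open import Data.List.Relation.Binary.Permutation.Propositional using (↭-sym)
open import Data.List.Relation.Binary.Permutation.Propositional.Properties
  using (∈-resp-↭; All-resp-↭)
open import Data.List.Relation.Unary.All using (All; []; _∷_)
open import Data.List.Relation.Unary.All.Properties using (all-filter)
open import Data.List.Relation.Unary.Any using (here; there)
open import Data.List.Relation.Unary.Linked using (Linked; []; [-]; _∷_)
import Data.List.Sort
open import Data.Nat as ℕ using (ℕ; zero; suc; z≤n; s≤s; _⊓_)
open import Data.Nat.Induction using (<-wellFounded)
import Data.Nat.Properties as ℕₚ
open import Data.Product using (∃; _×_; _,_; proj₁; proj₂)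
open import Data.Rational using (ℚ; 0ℚ; _+_; _⊔_; _≤_; _<_; _≥_; _≤?_; _<?_)
import Data.Rational.Properties as ℚₚ
import Data.Sum as Sum
open import Data.Sum using (inj₁; inj₂)
open import Function using (_∘_)
open import Induction.WellFounded using (module Subrelation)
import Relation.Binary.Construct.Flip.EqAndOrd as Flip
import Relation.Binary.Construct.On as On
open import Relation.Binary.Definitions using (tri<; tri≈; tri>)
open import Relation.Binary.PropositionalEquality
open import Relation.Nullary using (Dec; yes; no; ¬_; contradiction)
open import Relation.Unary using (Pred; Decidable; _⊆_)

record Least {n p} (P : Pred (Fin n) p) (i : Fin n) : Set p where
  field
    holds   : P i
    minimal : ∀ {j} → j Fin.< i → ¬ P j

Least-suc : ∀ {n p} {P : Pred (Fin (suc n)) p} {i} →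
            ¬ P zero → Least (P ∘ suc) i → Least P (suc i)
Least-suc ¬P₀ l = record
  { holds   = holds
  ; minimal = λ { {zero} _ → ¬P₀ ; {suc j} (s≤s j<i) → minimal j<i } }
  where open Least l

least : ∀ {n p} {P : Pred (Fin n) p} → Decidable P → ∃ P → ∃ (Least P)
least P? (zero , P₀) = zero , record { holds = P₀ ; minimal = λ () }
least P? (suc i , Pi) with P? zero
... | yes P₀ = zero , record { holds = P₀ ; minimal = λ () }
... | no ¬P₀ = let k , lk = least (P? ∘ suc) (i , Pi) in suc k , Least-suc ¬P₀ lk

Least-unique : ∀ {n p q} {P : Pred (Fin n) p} {Q : Pred (Fin n) q} {i j} →
               P ⊆ Q → Q ⊆ P → Least P i → Least Q j → i ≡ j
Least-unique {i = i} {j} P⊆Q Q⊆P lp lq with Finₚ.<-cmp i j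
... | tri< i<j _ _ = contradiction (P⊆Q (Least.holds lp)) (Least.minimal lq i<j)
... | tri≈ _ i≡j _ = i≡j
... | tri> _ _ j<i = contradiction (Q⊆P (Least.holds lq)) (Least.minimal lp j<i)

lookupOr0 : List ℚ → ℕ → ℚ
lookupOr0 []       _       = 0ℚ
lookupOr0 (r ∷ _)  zero    = r
lookupOr0 (_ ∷ rs) (suc l) = lookupOr0 rs l

lookupOr0-length : ∀ rs → lookupOr0 rs (length rs) ≡ 0ℚ
lookupOr0-length []       = refl
lookupOr0-length (_ ∷ rs) = lookupOr0-length rs

lookupOr0-nonneg : ∀ {rs} → All (0ℚ <_) rs → ∀ l → 0ℚ ≤ lookupOr0 rs l
lookupOr0-nonneg []          _       = ℚₚ.≤-refl
lookupOr0-nonneg (0<r ∷ _)   zero    = ℚₚ.<⇒≤ 0<r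
lookupOr0-nonneg (_   ∷ pos) (suc l) = lookupOr0-nonneg pos l

lookupOr0-positive : ∀ {rs l} → All (0ℚ <_) rs → l ℕ.< length rs → 0ℚ < lookupOr0 rs l
lookupOr0-positive {l = zero}  (0<r ∷ _)   _         = 0<r
lookupOr0-positive {l = suc l} (_   ∷ pos) (s≤s l<) = lookupOr0-positive pos l<

lookupOr0-antitone : ∀ {rs i j} → Linked _≥_ rs → All (0ℚ <_) rs →
                     i ℕ.≤ j → lookupOr0 rs j ≤ lookupOr0 rs i
lookupOr0-antitone {i = zero}  {zero}  _            _         _         = ℚₚ.≤-refl
lookupOr0-antitone {i = suc _} {zero}  _            _         ()
lookupOr0-antitone                     []           _         _         = ℚₚ.≤-refl
lookupOr0-antitone {i = zero}  {suc _} [-]          (0<r ∷ _) _         = ℚₚ.<⇒≤ 0<r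
lookupOr0-antitone {i = zero}  {suc j} (r≥s ∷ desc) (_ ∷ pos) _         =
  ℚₚ.≤-trans (lookupOr0-antitone {j = j} desc pos z≤n) r≥s
lookupOr0-antitone {i = suc _} {suc _} [-]          _         _         = ℚₚ.≤-refl
lookupOr0-antitone {i = suc _} {suc _} (_ ∷ desc)   (_ ∷ pos) (s≤s i≤j) =
  lookupOr0-antitone desc pos i≤j

∈⇒lookupOr0 : ∀ {r rs} → r ∈ rs → ∃ λ l → lookupOr0 rs l ≡ r
∈⇒lookupOr0 (here refl) = zero , refl
∈⇒lookupOr0 (there r∈)  = let l , eq = ∈⇒lookupOr0 r∈ in suc l , eq

⊔≤+ : ∀ {p q} → 0ℚ ≤ p → 0ℚ ≤ q → p ⊔ q ≤ p + q
⊔≤+ {p} {q} 0≤p 0≤q = ℚₚ.⊔-lub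
  (subst (_≤ p + q) (ℚₚ.+-identityʳ p) (ℚₚ.+-monoʳ-≤ p 0≤q))
  (subst (_≤ p + q) (ℚₚ.+-identityˡ q) (ℚₚ.+-monoˡ-≤ q 0≤p))

record Scale {n} (d : Fin n → Fin n → ℚ) : Set where
  field
    depth           : ℕ
    radius          : ℕ → ℚ
    radius-antitone : ∀ {i j} → i ℕ.≤ j → radius j ≤ radius i
    radius-nonneg   : ∀ l → 0ℚ ≤ radius l
    radius-positive : ∀ {l} → l ℕ.< depth → 0ℚ < radius l
    radius-depth    : radius depth ≡ 0ℚ
    radius-hits     : ∀ {x y} → 0ℚ < d x y → ∃ λ l → radius l ≡ d x y

  radius-⊓ : ∀ i j → radius (i ⊓ j) ≡ radius i ⊔ radius j
  radius-⊓ i j with ℕₚ.≤-total i j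
  ... | inj₁ i≤j = trans (cong radius (ℕₚ.m≤n⇒m⊓n≡m i≤j))
                         (sym (ℚₚ.p≥q⇒p⊔q≡p (radius-antitone i≤j)))
  ... | inj₂ j≤i = trans (cong radius (ℕₚ.m≥n⇒m⊓n≡n j≤i))
                         (sym (ℚₚ.p≤q⇒p⊔q≡q (radius-antitone j≤i)))

  radius≤0⇒depth : ∀ {l} → l ℕ.≤ depth → radius l ≤ 0ℚ → l ≡ depth
  radius≤0⇒depth l≤ r≤0 with ℕₚ.m≤n⇒m<n∨m≡n l≤
  ... | inj₁ l<depth = contradiction (ℚₚ.<-≤-trans (radius-positive l<depth) r≤0)
                                     (ℚₚ.<-irrefl refl)
  ... | inj₂ l≡depth = l≡depth

  radius-between : ∀ x y m →
    ∃ λ l → l ℕ.≤ m × d x y ≤ radius l × radius l ≤ d x y ⊔ radius m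
  radius-between x y m with d x y ≤? radius m
  ... | yes d≤ = m , ℕₚ.≤-refl , d≤ , ℚₚ.p≤q⊔p (d x y) (radius m)
  ... | no d≰ with radius-hits (ℚₚ.≤-<-trans (radius-nonneg m) (ℚₚ.≰⇒> d≰))
  ...   | l , rl≡d with ℕₚ.≤-total l m
  ...     | inj₁ l≤m = l , l≤m , ℚₚ.≤-reflexive (sym rl≡d) ,
                       subst (_≤ d x y ⊔ radius m) (sym rl≡d) (ℚₚ.p≤p⊔q (d x y) (radius m))
  ...     | inj₂ m≤l = contradiction (subst (_≤ radius m) rl≡d (radius-antitone m≤l)) d≰

distanceScale : ∀ {n} (d : Fin n → Fin n → ℚ) → Scale d
distanceScale {n} d = record
  { depth           = length radii
  ; radius          = lookupOr0 radii
  ; radius-antitone = lookupOr0-antitone (sort-↗ positives) radii-positive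
  ; radius-nonneg   = lookupOr0-nonneg radii-positive
  ; radius-positive = lookupOr0-positive radii-positive
  ; radius-depth    = lookupOr0-length radii
  ; radius-hits     = ∈⇒lookupOr0 ∘ positive-∈-radii
  }
  where
  open Data.List.Sort (Flip.decTotalOrder ℚₚ.≤-decTotalOrder) using (sort; sort-↭; sort-↗)

  distances : List ℚ
  distances = cartesianProductWith d (allFin n) (allFin n)

  positives : List ℚ
  positives = filter (0ℚ <?_) distances

  radii : List ℚ
  radii = sort positives

  radii-positive : All (0ℚ <_) radii
  radii-positive = All-resp-↭ (↭-sym (sort-↭ positives)) (all-filter (0ℚ <?_) distances)

  positive-∈-radii : ∀ {x y} → 0ℚ < d x y → d x y ∈ radii
  positive-∈-radii {x} {y} 0<d = ∈-resp-↭ (↭-sym (sort-↭ positives))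
    (∈-filter⁺ (0ℚ <?_) (∈-cartesianProductWith⁺ d (∈-allFin x) (∈-allFin y)) 0<d)

module BallTree {n} {d : Fin n → Fin n → ℚ}
  (metric : IsMetric d) (ultrametric : IsUltrametric d) (scale : Scale d) where

  open IsMetric metric
  open Scale scale

  ≤-ultra : ∀ {x y z r} → d x y ≤ r → d y z ≤ r → d x z ≤ r
  ≤-ultra {x} {y} {z} dxy≤ dyz≤ = ℚₚ.≤-trans (ultrametric x y z) (ℚₚ.⊔-lub dxy≤ dyz≤)

  ≤-sym : ∀ {x y r} → d x y ≤ r → d y x ≤ r
  ≤-sym {x} {y} {r} = subst (_≤ r) (symm x y)

  leastInBall : ∀ l x → ∃ (Least λ z → d z x ≤ radius l)
  leastInBall l x = least (λ z → d z x ≤? radius l)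
                          (x , subst (_≤ radius l) (sym (self x)) (radius-nonneg l))

  rep : ℕ → Fin n → Fin n
  rep l x = proj₁ (leastInBall l x)

  rep-close : ∀ l x → d (rep l x) x ≤ radius l
  rep-close l x = Least.holds (proj₂ (leastInBall l x))

  rep-cong : ∀ {l x y} → d x y ≤ radius l → rep l x ≡ rep l y
  rep-cong {l} {x} {y} dxy≤ =
    Least-unique (λ dzx≤ → ≤-ultra dzx≤ dxy≤) (λ dzy≤ → ≤-ultra dzy≤ (≤-sym dxy≤))
                 (proj₂ (leastInBall l x)) (proj₂ (leastInBall l y))

  rep-rep : ∀ {l m} x → l ℕ.≤ m → rep l (rep m x) ≡ rep l x
  rep-rep {l} {m} x l≤m = rep-cong (ℚₚ.≤-trans (rep-close m x) (radius-antitone l≤m))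

  rep-depth : ∀ x → rep depth x ≡ x
  rep-depth x = zero⇒≡ _ _ (ℚₚ.≤-antisym
    (subst (d (rep depth x) x ≤_) radius-depth (rep-close depth x)) (nonneg _ _))

  record Ball : Set where
    constructor ball
    field
      level   : ℕ
      centre  : Fin n
      level≤  : level ℕ.≤ depth
      centred : rep level centre ≡ centre

  open Ball

  ball-≡ : ∀ {a b} → level a ≡ level b → centre a ≡ centre b → a ≡ b
  ball-≡ {ball l x p q} {ball .l .x p′ q′} refl refl =
    cong₂ (ball l x) (ℕₚ.≤-irrelevant p p′) (Decidable⇒UIP.≡-irrelevant Fin._≟_ q q′)

  _≟ᴮ_ : (a b : Ball) → Dec (a ≡ b)
  a ≟ᴮ b with level a ℕ.≟ level b | centre a Fin.≟ centre b
  ... | yes l≡ | yes c≡ = yes (ball-≡ l≡ c≡)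
  ... | no l≢  | _      = no (l≢ ∘ cong level)
  ... | _      | no c≢  = no (c≢ ∘ cong centre)

  -- a ≼ b: the ball b is contained in the ball a.
  record _≼_ (a b : Ball) : Set where
    constructor nested
    field
      level-≤  : level a ℕ.≤ level b
      centre-≡ : centre a ≡ rep (level a) (centre b)

  open _≼_

  ≼-refl : ∀ a → a ≼ a
  ≼-refl a = nested ℕₚ.≤-refl (sym (centred a))

  ≼-trans : ∀ {a b c} → a ≼ b → b ≼ c → a ≼ c
  ≼-trans {a} {b} {c} (nested la≤lb ca≡) (nested lb≤lc cb≡) =
    nested (ℕₚ.≤-trans la≤lb lb≤lc)
    (trans ca≡ (trans (cong (rep (level a)) cb≡) (rep-rep (centre c) la≤lb)))

  ancestors-level-≡ : ∀ {a b t} → a ≼ t → b ≼ t → level a ≡ level b → a ≡ b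
  ancestors-level-≡ {t = t} (nested _ ca≡) (nested _ cb≡) la≡lb =
    ball-≡ la≡lb (trans ca≡ (trans (cong (λ l → rep l (centre t)) la≡lb) (sym cb≡)))

  ≼-antisym : ∀ {a b} → a ≼ b → b ≼ a → a ≡ b
  ≼-antisym {b = b} a≼b b≼a =
    ancestors-level-≡ a≼b (≼-refl b) (ℕₚ.≤-antisym (level-≤ a≼b) (level-≤ b≼a))

  ≺⇒level< : ∀ {a b} → a ≼ b → a ≢ b → level a ℕ.< level b
  ≺⇒level< {b = b} a≼b a≢b with ℕₚ.m≤n⇒m<n∨m≡n (level-≤ a≼b)
  ... | inj₁ la<lb = la<lb
  ... | inj₂ la≡lb = contradiction (ancestors-level-≡ a≼b (≼-refl b) la≡lb) a≢b

  ancestors-≼ : ∀ {a b t} → a ≼ t → b ≼ t → level a ℕ.≤ level b → a ≼ b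
  ancestors-≼ {a} {b} {t} (nested _ ca≡) (nested _ cb≡) la≤lb =
    nested la≤lb (trans ca≡ (trans (sym (rep-rep (centre t) la≤lb)) (cong (rep (level a)) (sym cb≡))))

  ancestor : (t : Ball) (l : ℕ) → l ℕ.≤ level t → Ball
  ancestor t l l≤ = ball l (rep l (centre t)) (ℕₚ.≤-trans l≤ (level≤ t)) (rep-rep (centre t) ℕₚ.≤-refl)

  ancestor-≼ : ∀ t {l} (l≤ : l ℕ.≤ level t) → ancestor t l l≤ ≼ t
  ancestor-≼ t l≤ = nested l≤ refl

  open TreeNotions _≼_

  strictAncestor : (t : Ball) {l : ℕ} → l ℕ.< level t → StrictBelow t
  strictAncestor t {l} l< =
    ancestor t l (ℕₚ.<⇒≤ l<) , ancestor-≼ t (ℕₚ.<⇒≤ l<) , λ eq → ℕₚ.<-irrefl (cong level eq) l<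

  isTree : IsTree
  isTree = record
    { isPartialOrder = record
        { isPreorder = record
            { isEquivalence = isEquivalence
            ; reflexive     = λ { {a} refl → ≼-refl a }
            ; trans         = ≼-trans }
        ; antisym = ≼-antisym }
    ; belowLinear = λ t a b a≼t b≼t →
        Sum.map (ancestors-≼ a≼t b≼t) (ancestors-≼ b≼t a≼t) (ℕₚ.≤-total (level a) (level b))
    ; belowWF = λ t → Subrelation.wellFounded (λ (a≼b , a≢b) → ≺⇒level< a≼b a≢b)
                        (On.wellFounded (level ∘ proj₁) <-wellFounded) }

  -- The radius of the smallest ball containing both a and b, i.e. h of their meet.
  meetRadius : Ball → Ball → ℚ
  meetRadius a b = d (centre a) (centre b) ⊔ (radius (level a) ⊔ radius (level b))

  d≤meetRadius : ∀ a b → d (centre a) (centre b) ≤ meetRadius a b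
  d≤meetRadius a b = ℚₚ.p≤p⊔q (d (centre a) (centre b)) _

  radius≤meetRadiusˡ : ∀ a b → radius (level a) ≤ meetRadius a b
  radius≤meetRadiusˡ a b = ℚₚ.≤-trans (ℚₚ.p≤p⊔q (radius (level a)) (radius (level b)))
                                      (ℚₚ.p≤q⊔p (d (centre a) (centre b)) _)

  radius≤meetRadiusʳ : ∀ a b → radius (level b) ≤ meetRadius a b
  radius≤meetRadiusʳ a b = ℚₚ.≤-trans (ℚₚ.p≤q⊔p (radius (level a)) (radius (level b)))
                                      (ℚₚ.p≤q⊔p (d (centre a) (centre b)) _)

  meetRadius-nonneg : ∀ a b → 0ℚ ≤ meetRadius a b
  meetRadius-nonneg a b = ℚₚ.≤-trans (nonneg (centre a) (centre b)) (d≤meetRadius a b)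

  meetRadius-sym : ∀ a b → meetRadius a b ≡ meetRadius b a
  meetRadius-sym a b = cong₂ _⊔_ (symm (centre a) (centre b)) (ℚₚ.⊔-comm (radius (level a)) _)

  meetRadius-ultra : ∀ a b e → meetRadius a e ≤ meetRadius a b ⊔ meetRadius b e
  meetRadius-ultra a b e = ℚₚ.⊔-lub
    (ℚₚ.≤-trans (ultrametric (centre a) (centre b) (centre e))
                (ℚₚ.⊔-mono-≤ (d≤meetRadius a b) (d≤meetRadius b e)))
    (ℚₚ.⊔-lub (ℚₚ.≤-trans (radius≤meetRadiusˡ a b) (ℚₚ.p≤p⊔q (meetRadius a b) _))
              (ℚₚ.≤-trans (radius≤meetRadiusʳ b e) (ℚₚ.p≤q⊔p (meetRadius a b) _)))

  meetRadius≤0⇒≡ : ∀ a b → meetRadius a b ≤ 0ℚ → a ≡ b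
  meetRadius≤0⇒≡ a b m≤0 = ball-≡
    (trans (at-depth a (radius≤meetRadiusˡ a b)) (sym (at-depth b (radius≤meetRadiusʳ a b))))
    (zero⇒≡ _ _ (ℚₚ.≤-antisym (ℚₚ.≤-trans (d≤meetRadius a b) m≤0) (nonneg _ _)))
    where
    at-depth : ∀ c → radius (level c) ≤ meetRadius a b → level c ≡ depth
    at-depth c r≤ = radius≤0⇒depth (level≤ c) (ℚₚ.≤-trans r≤ m≤0)

  ρ : Ball → Ball → ℚ
  ρ a b with a ≟ᴮ b
  ... | yes _ = 0ℚ
  ... | no  _ = meetRadius a b

  ρ-≢ : ∀ {a b} → a ≢ b → ρ a b ≡ meetRadius a b
  ρ-≢ {a} {b} a≢b with a ≟ᴮ b
  ... | yes a≡b = contradiction a≡b a≢b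
  ... | no  _   = refl

  ρ-self : ∀ a → ρ a a ≡ 0ℚ
  ρ-self a with a ≟ᴮ a
  ... | yes _ = refl
  ... | no a≢a = contradiction refl a≢a

  ρ-nonneg : ∀ a b → 0ℚ ≤ ρ a b
  ρ-nonneg a b with a ≟ᴮ b
  ... | yes _ = ℚₚ.≤-refl
  ... | no  _ = meetRadius-nonneg a b

  ρ-sym : ∀ a b → ρ a b ≡ ρ b a
  ρ-sym a b with a ≟ᴮ b | b ≟ᴮ a
  ... | yes _   | yes _   = refl
  ... | no  _   | no  _   = meetRadius-sym a b
  ... | yes a≡b | no  b≢a = contradiction (sym a≡b) b≢a
  ... | no  a≢b | yes b≡a = contradiction (sym b≡a) a≢b

  ρ-zero⇒≡ : ∀ a b → ρ a b ≡ 0ℚ → a ≡ b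
  ρ-zero⇒≡ a b ρ≡0 with a ≟ᴮ b
  ... | yes a≡b = a≡b
  ... | no  _   = meetRadius≤0⇒≡ a b (ℚₚ.≤-reflexive ρ≡0)

  ρ-ultra : ∀ a b e → ρ a e ≤ ρ a b ⊔ ρ b e
  ρ-ultra a b e = by-cases (a ≟ᴮ b) (b ≟ᴮ e) (a ≟ᴮ e)
    where
    by-cases : ∀ {a b e} → Dec (a ≡ b) → Dec (b ≡ e) → Dec (a ≡ e) → ρ a e ≤ ρ a b ⊔ ρ b e
    by-cases {a} {e = e} (yes refl) _ _ = ℚₚ.p≤q⊔p (ρ a a) (ρ a e)
    by-cases {a} {b} (no _) (yes refl) _ = ℚₚ.p≤p⊔q (ρ a b) (ρ b b)
    by-cases {a} {b} (no _) (no _) (yes refl) =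
      subst (_≤ ρ a b ⊔ ρ b a) (sym (ρ-self a)) (ℚₚ.≤-trans (ρ-nonneg a b) (ℚₚ.p≤p⊔q _ _))
    by-cases {a} {b} {e} (no a≢b) (no b≢e) (no a≢e) rewrite ρ-≢ a≢e | ρ-≢ a≢b | ρ-≢ b≢e =
      meetRadius-ultra a b e

  isMetric : IsMetric ρ
  isMetric = record
    { nonneg   = ρ-nonneg
    ; self     = ρ-self
    ; zero⇒≡   = ρ-zero⇒≡
    ; symm     = ρ-sym
    ; triangle = λ a b e → ℚₚ.≤-trans (ρ-ultra a b e) (⊔≤+ (ρ-nonneg a b) (ρ-nonneg b e)) }

  ≼⇒close : ∀ {z a} → z ≼ a → d (centre z) (centre a) ≤ radius (level z)
  ≼⇒close {z} {a} (nested _ cz≡) = subst (λ w → d w (centre a) ≤ radius (level z)) (sym cz≡)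
                                     (rep-close (level z) (centre a))

  meetRadius-lower : ∀ {z a b} → z ≼ a → z ≼ b → meetRadius a b ≤ radius (level z)
  meetRadius-lower z≼a@(nested lz≤la _) z≼b@(nested lz≤lb _) = ℚₚ.⊔-lub
    (≤-ultra (≤-sym (≼⇒close z≼a)) (≼⇒close z≼b))
    (ℚₚ.⊔-lub (radius-antitone lz≤la) (radius-antitone lz≤lb))

  meetRadius-attained : ∀ a b → ∃ λ z → z ≼ a × z ≼ b × radius (level z) ≤ meetRadius a b
  meetRadius-attained a b with radius-between (centre a) (centre b) (level a ⊓ level b)
  ... | l , l≤m , dab≤ , rl≤ =
    ancestor a l l≤la , ancestor-≼ a l≤la , nested l≤lb (rep-cong dab≤) ,
    subst (λ r → radius l ≤ d (centre a) (centre b) ⊔ r) (radius-⊓ (level a) (level b)) rl≤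
    where
    l≤la = ℕₚ.≤-trans l≤m (ℕₚ.m⊓n≤m (level a) (level b))
    l≤lb = ℕₚ.≤-trans l≤m (ℕₚ.m⊓n≤n (level a) (level b))

  ρ-inf : ∀ a b → a ≢ b →
          IsInfimum (λ q → ∃ λ z → z ≼ a × z ≼ b × q ≡ radius (level z)) (ρ a b)
  ρ-inf a b a≢b rewrite ρ-≢ a≢b = lower , greatest
    where
    lower : ∀ q → (∃ λ z → z ≼ a × z ≼ b × q ≡ radius (level z)) → meetRadius a b ≤ q
    lower q (z , z≼a , z≼b , q≡) = subst (meetRadius a b ≤_) (sym q≡) (meetRadius-lower z≼a z≼b)
    greatest : ∀ q → (∀ s → (∃ λ z → z ≼ a × z ≼ b × s ≡ radius (level z)) → q ≤ s) →
               q ≤ meetRadius a b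
    greatest q below with meetRadius-attained a b
    ... | z , z≼a , z≼b , rz≤ = ℚₚ.≤-trans (below _ (z , z≼a , z≼b , refl)) rz≤

  ballTree : RationalTreeSpace
  ballTree = record
    { T         = Ball
    ; ρ         = ρ
    ; metric    = isMetric
    ; _≤_       = _≼_
    ; tree      = isTree
    ; h         = radius ∘ level
    ; h-nonincr = λ _ _ → radius-antitone ∘ level-≤
    ; ρ-inf     = ρ-inf }

  recentre : ∀ s t → level s ≡ level t → StrictBelow s → StrictBelow t
  recentre s t ls≡lt (z , z≼s , z≢s) =
    strictAncestor t (subst (level z ℕ.<_) ls≡lt (≺⇒level< z≼s z≢s))

  recentre-recentre : ∀ s t (ls≡lt : level s ≡ level t) (lt≡ls : level t ≡ level s) a →
                      proj₁ (recentre t s lt≡ls (recentre s t ls≡lt a)) ≡ proj₁ a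
  recentre-recentre _ _ _ _ (z , nested _ cz≡ , _) = ball-≡ refl (sym cz≡)

  recentre-mono : ∀ s t (ls≡lt : level s ≡ level t) (a a′ : StrictBelow s) → proj₁ a ≼ proj₁ a′ →
                  proj₁ (recentre s t ls≡lt a) ≼ proj₁ (recentre s t ls≡lt a′)
  recentre-mono _ t _ _ _ (nested la≤la′ _) = nested la≤la′ (sym (rep-rep (centre t) la≤la′))

  sameLevel⇒SameHeight : ∀ {s t} → level s ≡ level t → SameHeight s t
  sameLevel⇒SameHeight {s} {t} ls≡lt = record
    { to        = recentre s t ls≡lt
    ; from      = recentre t s (sym ls≡lt)
    ; from∘to   = recentre-recentre s t ls≡lt (sym ls≡lt)
    ; to∘from   = recentre-recentre t s (sym ls≡lt) ls≡lt
    ; to-mono   = recentre-mono s t ls≡lt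
    ; from-mono = recentre-mono t s (sym ls≡lt) }

  SameHeight-sym : ∀ {s t} → SameHeight s t → SameHeight t s
  SameHeight-sym sh = record
    { to = from ; from = to ; from∘to = to∘from ; to∘from = from∘to
    ; to-mono = from-mono ; from-mono = to-mono }
    where open SameHeight sh

  -- The strict ancestors of s, one per level below level s, inject into those of t.
  SameHeight⇒level≤ : ∀ {s t} → SameHeight s t → level s ℕ.≤ level t
  SameHeight⇒level≤ {s} {t} sh = Finₚ.injective⇒≤ image-injective
    where
    open SameHeight sh

    image : Fin (level s) → StrictBelow t
    image i = to (strictAncestor s (Finₚ.toℕ<n i))

    image-level< : ∀ i → level (proj₁ (image i)) ℕ.< level t
    image-level< i = let (_ , z≼t , z≢t) = image i in ≺⇒level< z≼t z≢t

    -- StrictBelow carries proofs, so equal balls need not be equal arguments of from.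
    from-cong : ∀ b b′ → proj₁ b ≡ proj₁ b′ → proj₁ (from b) ≡ proj₁ (from b′)
    from-cong b b′ eq = ≼-antisym (from-mono b b′ (subst (proj₁ b ≼_) eq (≼-refl _)))
                                  (from-mono b′ b (subst (_≼ proj₁ b) eq (≼-refl _)))

    image-injective : ∀ {i j} → fromℕ< (image-level< i) ≡ fromℕ< (image-level< j) → i ≡ j
    image-injective {i} {j} eq = Finₚ.toℕ-injective (cong level (begin
      proj₁ (strictAncestor s (Finₚ.toℕ<n i)) ≡⟨ sym (from∘to _) ⟩
      proj₁ (from (image i))                  ≡⟨ from-cong _ _ same-image ⟩
      proj₁ (from (image j))                  ≡⟨ from∘to _ ⟩
      proj₁ (strictAncestor s (Finₚ.toℕ<n j)) ∎))
      where
      open ≡-Reasoning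
      same-image : proj₁ (image i) ≡ proj₁ (image j)
      same-image = ancestors-level-≡ (proj₁ (proj₂ (image i))) (proj₁ (proj₂ (image j)))
                     (Finₚ.fromℕ<-injective _ _ (image-level< i) (image-level< j) eq)

  SameHeight⇒sameLevel : ∀ {s t} → SameHeight s t → level s ≡ level t
  SameHeight⇒sameLevel sh =
    ℕₚ.≤-antisym (SameHeight⇒level≤ sh) (SameHeight⇒level≤ (SameHeight-sym sh))

  leaf : Fin n → Ball
  leaf x = ball depth x ℕₚ.≤-refl (rep-depth x)

  leaf-isLeaf : ∀ x → IsLeaf (leaf x)
  leaf-isLeaf x t (nested depth≤lt x≡) =
    ball-≡ (ℕₚ.≤-antisym (level≤ t) depth≤lt) (trans (sym (rep-depth (centre t))) (sym x≡))

  ρ-leaf : ∀ x y → ρ (leaf x) (leaf y) ≡ d x y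
  ρ-leaf x y with leaf x ≟ᴮ leaf y
  ... | yes lx≡ly = subst (λ w → 0ℚ ≡ d x w) (cong centre lx≡ly) (sym (self x))
  ... | no  _ = trans (cong (λ r → d x y ⊔ (r ⊔ r)) radius-depth) (ℚₚ.p≥q⇒p⊔q≡p (nonneg x y))

  isRegularBranchSpace : IsRegularRationalBranchSpace d
  isRegularBranchSpace =
    ballTree , leaf , ρ-leaf , leaf-isLeaf ,
    (λ _ _ → sameLevel⇒SameHeight refl) ,
    (λ _ _ → cong radius ∘ SameHeight⇒sameLevel)

mainTheorem4 : (n : ℕ) (d : Fin n → Fin n → ℚ) →
    IsMetric d → IsUltrametric d → IsRegularRationalBranchSpace d
mainTheorem4 n d metric ultrametric =
  BallTree.isRegularBranchSpace metric ultrametric (distanceScale d)
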